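{- Let $D$ be a finite set with $|D|\ge2$, let $\mathcal{F}$ be a set of functions from powers of $D$ to $[0,1]_{\mathbb{Q}}$, and let $\Phi=\ell(\mathcal{F})$. If $\mathcal{F}$ is weakly log-supermodular then $\Phi$ is weakly submodular.
   Context: $[0,1]_{\mathbb{Q}}=[0,1]\cap\mathbb{Q}$. $\overline{\mathbb{R}}_{\ge0}=\mathbb{R}_{\ge0}\cup\{\infty\}$ with $x+\infty=\infty$, $x\le\infty$. For $F:D^k\to[0,1]_{\mathbb{Q}}$, $\ell(F):D^k\to\overline{\mathbb{R}}_{\ge0}$ is $\ell(F)(\mathbf{x})=-\ln F(\mathbf{x})$ if $F(\mathbf{x})>0$ and $\infty$ if $F(\mathbf{x})=0$; $\ell(\mathcal{F})=\{\ell(F):F\in\mathcal{F}\}$. Counting side: $\mathrm{EQ}(x,y)=1$ if $x=y$, else $0$. A pps-formula over $\mathcal{F}$ is $\sum_{v_{n+1},\dots,v_{n+k}}\prod_j\phi_j$ with each $\phi_j$ a function of $\mathcal{F}$ applied to a tuple of the variables (repetitions allowed), representing the function of $v_1,\dots,v_n$ obtained by summing over all assignments in $D^k$ to the bound variables; $\langle\mathcal{F}\rangle_\#$ is the set of functions represented by pps-formulas over $\mathcal{F}\cup\{\mathrm{EQ}\}$. $\mathcal{F}$ is weakly log-supermodular if for every binary $F\in\langle\mathcal{F}\rangle_\#$ and all $a,b\in D$: $F(a,a)F(b,b)\ge F(a,b)F(b,a)$ or $F(a,a)=F(b,b)=0$. Optimisation side: $\mathrm{eq}(x,x)=0$, $\mathrm{eq}(x,y)=\infty$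 for $x\neq y$. A psm-formula over $\Phi$ is $\min_{v_{n+1},\dots,v_{n+k}}\sum_j\phi_j$ with each $\phi_j$ a function of $\Phi$ applied to a tuple of variables, representing $f(\mathbf{x})=\min_{\mathbf{y}\in D^k}\sum_jf_{\phi_j}(\mathbf{x},\mathbf{y})$; the valued clone $\langle\Phi\rangle_{\min}$ is the set of functions representable by psm-formulas over $\Phi\cup\{\mathrm{eq}\}$. $\Phi$ is weakly submodular if for every binary $f\in\langle\Phi\rangle_{\min}$ and all $a,b\in D$: $f(a,a)+f(b,b)\le f(a,b)+f(b,a)$ or $f(a,a)=f(b,b)=\infty$. -}

module Defs where

open import Data.Nat using (ℕ; zero; suc)
open import Data.Fin using (Fin; zero; suc)
open import Data.Sum using (_⊎_; inj₁; inj₂; [_,_])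
open import Data.Product using (Σ; _×_; _,_)
open import Data.List using (List; []; _∷_; map; concatMap; foldr; allFin)
open import Data.Rational using (ℚ; 0ℚ; 1ℚ; _+_; _*_; _⊔_; _≤_)
open import Relation.Binary.PropositionalEquality using (_≡_)
open import Relation.Nullary using (yes; no)
open import Function using (_∘_)

-- Domain D = Fin d.  A k-ary function D^k → A is a map (Fin k → Fin d) → A.

Fun : ℕ → ℕ → Set → Set
Fun d k A = (Fin k → Fin d) → A

FunSet : ℕ → Set → Set₁
FunSet d A = (k : ℕ) → Fun d k A → Set

pair : {d : ℕ} → Fin d → Fin d → Fin 2 → Fin d
pair a b zero = a
pair a b (suc _) = b

cons : {d m : ℕ} → Fin d → (Fin m → Fin d) → Fin (suc m) → Fin d
cons a y zero = a
cons a y (suc i) = y i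

assignments : (d m : ℕ) → List (Fin m → Fin d)
assignments d zero = (λ ()) ∷ []
assignments d (suc m) =
  concatMap (λ a → map (cons a) (assignments d m)) (allFin d)

-- Primitive-positive formulas (shared syntax for pps- and psm-formulas).
-- Free variables: Fin n, bound variables: Fin m.

data Atom (d : ℕ) (A : Set) (S : FunSet d A) (V : Set) : Set where
  eqA : V → V → Atom d A S V
  fnA : (k : ℕ) (f : Fun d k A) → S k f → (Fin k → V) → Atom d A S V

record Formula (d : ℕ) (A : Set) (S : FunSet d A) (n : ℕ) : Set where
  constructor formula
  field
    m     : ℕ
    atoms : List (Atom d A S (Fin n ⊎ Fin m))

module Eval (d : ℕ) (A : Set) (S : FunSet d A)
            (eqv : Fun d 2 A)
            (_⊙_ : A → A → A) (unit : A)   -- combine atoms (product / sum)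
            (_⊞_ : A → A → A) (zer : A)    -- aggregate (sum / min)
            where
  evalAtom : {V : Set} → (V → Fin d) → Atom d A S V → A
  evalAtom σ (eqA u v) = eqv (pair (σ u) (σ v))
  evalAtom σ (fnA k f _ s) = f (σ ∘ s)

  eval : {n : ℕ} → Formula d A S n → Fun d n A
  eval (formula m atoms) x =
    foldr _⊞_ zer
      (map (λ y → foldr _⊙_ unit (map (evalAtom [ x , y ]) atoms))
           (assignments d m))

EQ : {d : ℕ} → Fun d 2 ℚ
EQ x with x zero Data.Fin.≟ x (suc zero)
... | yes _ = 1ℚ
... | no  _ = 0ℚ

PPSClone : {d : ℕ} → FunSet d ℚ → FunSet d ℚ
PPSClone {d} 𝓕 n F =
  Σ (Formula d ℚ 𝓕 n) λ φ → ∀ x → Eval.eval d ℚ 𝓕 EQ _*_ 1ℚ _+_ 0ℚ φ x ≡ F x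

WeaklyLogSupermodular : {d : ℕ} → FunSet d ℚ → Set
WeaklyLogSupermodular {d} 𝓕 =
  (F : Fun d 2 ℚ) → PPSClone 𝓕 2 F → (a b : Fin d) →
    (F (pair a b) * F (pair b a) ≤ F (pair a a) * F (pair b b))
    ⊎ (F (pair a a) ≡ 0ℚ × F (pair b b) ≡ 0ℚ)

-- Every value
-- occurring here lies in ℓ([0,1]_ℚ) = { -ln q : q ∈ [0,1]_ℚ } ⊆ ℝ̄≥0
-- (with -ln 0 = ∞), which is closed under +, min and contains 0, ∞.
-- We therefore represent the extended non-negative real -ln q by the
-- rational q itself (the map q ↦ -ln q is injective on [0,1]_ℚ).  Under
-- this representation:
--   (-ln p) + (-ln q) = -ln (p * q)
--   min (-ln p) (-ln q) = -ln (p ⊔ q)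
--   (-ln p) ≤ (-ln q)  ⇔  q ≤ p
--   ∞ = -ln 0,  0 = -ln 1.

record Cost : Set where
  constructor e^-
  field
    q : ℚ

∞ : Cost
∞ = e^- 0ℚ

𝟘 : Cost
𝟘 = e^- 1ℚ

infixl 6 _⊕_
_⊕_ : Cost → Cost → Cost
e^- p ⊕ e^- q = e^- (p * q)

_min_ : Cost → Cost → Cost
e^- p min e^- q = e^- (p ⊔ q)

infix 4 _≼_
_≼_ : Cost → Cost → Set
e^- p ≼ e^- q = q ≤ p

ℓ : {d k : ℕ} → Fun d k ℚ → Fun d k Cost
ℓ F x = e^- (F x)

ℓSet : {d : ℕ} → FunSet d ℚ → FunSet d Cost
ℓSet {d} 𝓕 k f = Σ (Fun d k ℚ) λ F → 𝓕 k F × (∀ x → f x ≡ ℓ F x)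

eq : {d : ℕ} → Fun d 2 Cost
eq x with x zero Data.Fin.≟ x (suc zero)
... | yes _ = 𝟘
... | no  _ = ∞

PSMClone : {d : ℕ} → FunSet d Cost → FunSet d Cost
PSMClone {d} Φ n f =
  Σ (Formula d Cost Φ n) λ φ → ∀ x → Eval.eval d Cost Φ eq _⊕_ 𝟘 _min_ ∞ φ x ≡ f x

WeaklySubmodular : {d : ℕ} → FunSet d Cost → Set
WeaklySubmodular {d} Φ =
  (f : Fun d 2 Cost) → PSMClone Φ 2 f → (a b : Fin d) →
    (f (pair a a) ⊕ f (pair b b) ≼ f (pair a b) ⊕ f (pair b a))
    ⊎ (f (pair a a) ≡ ∞ × f (pair b b) ≡ ∞)

-- Identify the cost -ln q with q.  A psm-formula over ℓ(𝓕) then evaluates to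
-- G(x) = max_y ∏ atoms(x, y), while the pps-formula over 𝓕 that repeats every atom N times
-- evaluates to F_N(x) = Σ_y (∏ atoms(x, y))^N, so G(x)^N ≤ F_N(x) ≤ K · G(x)^N where K is the
-- number of assignments to the bound variables.  Weak log-supermodularity of F_N therefore gives
-- (G(a,b) G(b,a))^N ≤ K² (G(a,a) G(b,b))^N for every N ≥ 1, and since by Bernoulli's inequality
-- p^N outgrows any multiple of q^N when q < p, this forces G(a,b) G(b,a) ≤ G(a,a) G(b,b).  In the
-- other case F_N(a,a) = F_N(b,b) = 0, which forces G(a,a) = G(b,b) = 0, i.e. infinite costs.
module Submission where

open import Defs
open import Data.Nat using (ℕ; _≤_)
open import Data.Product using (_×_)
open import Data.Rational using (ℚ; 0ℚ; 1ℚ) renaming (_≤_ to _≤ℚ_)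

open import Data.Nat as ℕ using (zero; suc)
open import Data.Integer as ℤ using (+_; +≤+; -≤+; -[1+_])
import Data.Integer.Properties as ℤ
open import Data.Product as Prod using (∃; _,_; proj₁; proj₂)
open import Data.Sum as Sum using (_⊎_; inj₁; inj₂; [_,_])
open import Data.Empty using (⊥-elim)
open import Data.Fin as Fin using (Fin)
open import Data.List using (List; []; _∷_; _++_; map; foldr; concat; replicate; length)
open import Data.List.Properties using (map-cong)
open import Function using (_∘_)
open import Relation.Nullary using (yes; no)
open import Relation.Binary.PropositionalEquality hiding ([_])
open import Data.Rational
  using (mkℚ; _+_; _*_; _⊔_; _-_; -_; _<_; *≤*; ↥_; 1/_; Positive; positive; nonNegative)
open import Data.Rational.Literals using (fromℤ)
open import Data.Rational.Properties
open import Data.Rational.Solver using (module +-*-Solver)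
import Data.Rational.Unnormalised as ℚᵘ
import Data.Rational.Unnormalised.Properties as ℚᵘ
open import Algebra.Bundles using (CommutativeRing)
open CommutativeRing +-*-commutativeRing using (commutativeSemiring; semiring)
open import Algebra.Properties.CommutativeSemiring.Exp commutativeSemiring using (_^_; ^-distrib-*)
open import Algebra.Properties.Semiring.Mult semiring
  using (×-comm-*; ×-assoc-*; ×-assocˡ) renaming (_×_ to _·_)

open +-*-Solver using (solve; _:=_; _:+_; _:*_; _:-_; con)

*-nonNeg : ∀ {p q} → 0ℚ ≤ℚ p → 0ℚ ≤ℚ q → 0ℚ ≤ℚ p * q
*-nonNeg {p} {q} 0≤p 0≤q =
  nonNegative⁻¹ _ {{nonNeg*nonNeg⇒nonNeg p {{nonNegative 0≤p}} q {{nonNegative 0≤q}}}}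

*-mono-≤-nonNeg : ∀ {p p′ q q′} → 0ℚ ≤ℚ p′ → 0ℚ ≤ℚ q → p ≤ℚ p′ → q ≤ℚ q′ → p * q ≤ℚ p′ * q′
*-mono-≤-nonNeg {p′ = p′} {q} 0≤p′ 0≤q p≤p′ q≤q′ =
  ≤-trans (*-monoʳ-≤-nonNeg q {{nonNegative 0≤q}} p≤p′)
          (*-monoˡ-≤-nonNeg p′ {{nonNegative 0≤p′}} q≤q′)

p≤p+q : ∀ {p q} → 0ℚ ≤ℚ q → p ≤ℚ p + q
p≤p+q {p} {q} 0≤q = subst (_≤ℚ p + q) (+-identityʳ p) (+-monoʳ-≤ p 0≤q)

q≤p+q : ∀ {p q} → 0ℚ ≤ℚ p → q ≤ℚ p + q
q≤p+q {p} {q} 0≤p = subst (_≤ℚ p + q) (+-identityˡ q) (+-monoˡ-≤ q 0≤p)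

^-nonNeg : ∀ n {p} → 0ℚ ≤ℚ p → 0ℚ ≤ℚ p ^ n
^-nonNeg zero    _   = nonNegative⁻¹ 1ℚ
^-nonNeg (suc n) 0≤p = *-nonNeg 0≤p (^-nonNeg n 0≤p)

^-pos : ∀ n {p} → 0ℚ < p → 0ℚ < p ^ n
^-pos zero    _   = positive⁻¹ 1ℚ
^-pos (suc n) {p} 0<p =
  positive⁻¹ _ {{pos*pos⇒pos p {{positive 0<p}} (p ^ n) {{positive (^-pos n 0<p)}}}}

^-mono-≤ : ∀ n {p q} → 0ℚ ≤ℚ p → p ≤ℚ q → p ^ n ≤ℚ q ^ n
^-mono-≤ zero    _   _   = ≤-refl
^-mono-≤ (suc n) 0≤p p≤q =
  *-mono-≤-nonNeg (≤-trans 0≤p p≤q) (^-nonNeg n 0≤p) p≤q (^-mono-≤ n 0≤p p≤q)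

^≤0⇒≡0 : ∀ n {p} → 0ℚ ≤ℚ p → p ^ suc n ≤ℚ 0ℚ → p ≡ 0ℚ
^≤0⇒≡0 n {p} 0≤p p^n≤0 with p ≤? 0ℚ
... | yes p≤0 = ≤-antisym p≤0 0≤p
... | no  p≰0 = ⊥-elim (<-irrefl refl (<-≤-trans (^-pos (suc n) (≰⇒> p≰0)) p^n≤0))

·-zeroʳ : ∀ n → n · 0ℚ ≡ 0ℚ
·-zeroʳ zero    = refl
·-zeroʳ (suc n) = trans (+-identityˡ (n · 0ℚ)) (·-zeroʳ n)

·-nonNeg : ∀ n {p} → 0ℚ ≤ℚ p → 0ℚ ≤ℚ n · p
·-nonNeg zero    _   = ≤-refl
·-nonNeg (suc n) 0≤p = ≤-trans 0≤p (p≤p+q (·-nonNeg n 0≤p))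

·-monoʳ-≤ : ∀ n {p q} → p ≤ℚ q → n · p ≤ℚ n · q
·-monoʳ-≤ zero    _   = ≤-refl
·-monoʳ-≤ (suc n) p≤q = +-mono-≤ p≤q (·-monoʳ-≤ n p≤q)

·-*-· : ∀ m n p q → (m · p) * (n · q) ≡ (m ℕ.* n) · (p * q)
·-*-· m n p q = begin
  (m · p) * (n · q)     ≡⟨ ×-assoc-* m p (n · q) ⟩
  m · (p * (n · q))     ≡⟨ cong (m ·_) (×-comm-* n p q) ⟩
  m · (n · (p * q))     ≡⟨ ×-assocˡ (p * q) m n ⟩
  (m ℕ.* n) · (p * q)   ∎
  where open ≡-Reasoning

·1≡fromℤ : ∀ n → n · 1ℚ ≡ fromℤ (+ n)
·1≡fromℤ zero = refl
·1≡fromℤ (suc n) rewrite ·1≡fromℤ n =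
  toℚᵘ-injective (ℚᵘ.≃-trans (toℚᵘ-homo-+ 1ℚ (fromℤ (+ n)))
    (ℚᵘ.*≡* (cong (ℤ._* + 1) (cong (ℤ._+_ (+ 1)) (ℤ.*-identityʳ (+ n))))))

≤∣↥∣·1 : ∀ p → p ≤ℚ ℤ.∣ ↥ p ∣ · 1ℚ
≤∣↥∣·1 p rewrite ·1≡fromℤ ℤ.∣ ↥ p ∣ with p
... | mkℚ (+ n)    _ _ = *≤* (ℤ.*-monoˡ-≤-nonNeg (+ n) (+≤+ (ℕ.s≤s ℕ.z≤n)))
... | mkℚ -[1+ n ] _ _ = *≤* -≤+

archimedean : ∀ p δ .{{_ : Positive δ}} → ∃ λ n → p ≤ℚ n · δ
archimedean p δ = n , (begin
    p                ≡⟨ sym (*-identityʳ p) ⟩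
    p * 1ℚ           ≡⟨ cong (p *_) (sym (*-inverseˡ δ {{pos⇒nonZero δ}})) ⟩
    p * (1/δ * δ)    ≡⟨ sym (*-assoc p 1/δ δ) ⟩
    (p * 1/δ) * δ    ≤⟨ *-monoʳ-≤-nonNeg δ {{pos⇒nonNeg δ}} (≤∣↥∣·1 (p * 1/δ)) ⟩
    (n · 1ℚ) * δ     ≡⟨ trans (×-assoc-* n 1ℚ δ) (cong (n ·_) (*-identityˡ δ)) ⟩
    n · δ            ∎)
  where
  open ≤-Reasoning
  1/δ : ℚ
  1/δ = (1/ δ) {{pos⇒nonZero δ}}
  n : ℕ
  n = ℤ.∣ ↥ (p * 1/δ) ∣

bernoulli : ∀ n {q δ} → 0ℚ ≤ℚ q → 0ℚ ≤ℚ δ → q ^ n * (q + suc n · δ) ≤ℚ (q + δ) ^ suc n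
bernoulli zero {q} {δ} _ _ = ≤-reflexive
  (solve 2 (λ q δ → con 1ℚ :* (q :+ (δ :+ con 0ℚ)) := (q :+ δ) :* con 1ℚ) refl q δ)
bernoulli (suc n) {q} {δ} 0≤q 0≤δ = begin
  q ^ suc n * (q + (δ + s))   ≡⟨ solve 4 (λ q qⁿ s δ → (q :* qⁿ) :* (q :+ (δ :+ s))
                                     := qⁿ :* (q :* (q :+ s) :+ q :* δ)) refl q (q ^ n) s δ ⟩
  q ^ n * (q * X + q * δ)     ≤⟨ *-monoˡ-≤-nonNeg (q ^ n) {{nonNegative (^-nonNeg n 0≤q)}}
                                   (+-monoʳ-≤ (q * X) (*-monoʳ-≤-nonNeg δ {{nonNegative 0≤δ}} q≤X)) ⟩
  q ^ n * (q * X + X * δ)     ≡⟨ solve 4 (λ q qⁿ X δ → qⁿ :* (q :* X :+ X :* δ)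
                                     := (q :+ δ) :* (qⁿ :* X)) refl q (q ^ n) X δ ⟩
  (q + δ) * (q ^ n * X)       ≤⟨ *-monoˡ-≤-nonNeg (q + δ) {{nonNegative (≤-trans 0≤q (p≤p+q 0≤δ))}}
                                   (bernoulli n 0≤q 0≤δ) ⟩
  (q + δ) * (q + δ) ^ suc n   ∎
  where
  open ≤-Reasoning
  s X : ℚ
  s = suc n · δ
  X = q + s
  q≤X : q ≤ℚ X
  q≤X = p≤p+q (·-nonNeg (suc n) 0≤δ)

^-dominates-· : ∀ m {p q} → 0ℚ ≤ℚ q → q < p → ∃ λ n → m · q ^ suc n < p ^ suc n
^-dominates-· m {p} {q} 0≤q q<p with q ≤? 0ℚ
... | yes q≤0 = 0 , (begin-strict
  m · q ^ 1       ≡⟨ cong (λ r → m · r ^ 1) (≤-antisym q≤0 0≤q) ⟩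
  m · 0ℚ          ≡⟨ ·-zeroʳ m ⟩
  0ℚ              ≤⟨ 0≤q ⟩
  q               <⟨ q<p ⟩
  p               ≡⟨ sym (*-identityʳ p) ⟩
  p ^ 1           ∎)
  where open ≤-Reasoning
... | no  q≰0 = k , (begin-strict
  m · q ^ suc k            ≡⟨ cong (m ·_) (*-comm q (q ^ k)) ⟩
  m · (q ^ k * q)          ≡⟨ sym (×-comm-* m (q ^ k) q) ⟩
  q ^ k * (m · q)          <⟨ *-monoʳ-<-pos (q ^ k) {{positive (^-pos k 0<q)}} m·q<X ⟩
  q ^ k * (q + suc k · δ)  ≤⟨ bernoulli k 0≤q (<⇒≤ 0<δ) ⟩
  (q + δ) ^ suc k          ≡⟨ cong (_^ suc k) (solve 2 (λ p q → q :+ (p :- q) := p) refl p q) ⟩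
  p ^ suc k                ∎)
  where
  open ≤-Reasoning
  0<q : 0ℚ < q
  0<q = ≰⇒> q≰0
  δ : ℚ
  δ = p - q
  0<δ : 0ℚ < δ
  0<δ = subst (_< δ) (+-inverseʳ q) (+-monoˡ-< (- q) q<p)
  instance
    δ-pos : Positive δ
    δ-pos = positive 0<δ
  k : ℕ
  k = proj₁ (archimedean (m · q) δ)
  m·q<X : m · q < q + suc k · δ
  m·q<X = begin-strict
    m · q            ≤⟨ proj₂ (archimedean (m · q) δ) ⟩
    k · δ            ≡⟨ sym (+-identityˡ (k · δ)) ⟩
    0ℚ + k · δ       <⟨ +-monoˡ-< (k · δ) 0<δ ⟩
    suc k · δ        ≤⟨ q≤p+q 0≤q ⟩
    q + suc k · δ    ∎

module _ {A : Set} where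

  maxOf sumOf productOf : (A → ℚ) → List A → ℚ
  maxOf     g = foldr _⊔_ 0ℚ ∘ map g
  sumOf     g = foldr _+_ 0ℚ ∘ map g
  productOf g = foldr _*_ 1ℚ ∘ map g

  productOf-++ : ∀ g xs ys → productOf g (xs ++ ys) ≡ productOf g xs * productOf g ys
  productOf-++ g []       ys = sym (*-identityˡ (productOf g ys))
  productOf-++ g (x ∷ xs) ys = trans (cong (g x *_) (productOf-++ g xs ys))
                                     (sym (*-assoc (g x) (productOf g xs) (productOf g ys)))

  productOf-concat-replicate : ∀ g N xs → productOf g (concat (replicate N xs)) ≡ productOf g xs ^ N
  productOf-concat-replicate g zero    xs = refl
  productOf-concat-replicate g (suc N) xs =
    trans (productOf-++ g xs (concat (replicate N xs)))
          (cong (productOf g xs *_) (productOf-concat-replicate g N xs))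

  productOf-nonNeg : ∀ {g} → (∀ x → 0ℚ ≤ℚ g x) → ∀ xs → 0ℚ ≤ℚ productOf g xs
  productOf-nonNeg g≥0 []       = nonNegative⁻¹ 1ℚ
  productOf-nonNeg g≥0 (x ∷ xs) = *-nonNeg (g≥0 x) (productOf-nonNeg g≥0 xs)

  module _ {g : A → ℚ} (g≥0 : ∀ y → 0ℚ ≤ℚ g y) where

    maxOf-nonNeg : ∀ ys → 0ℚ ≤ℚ maxOf g ys
    maxOf-nonNeg []       = ≤-refl
    maxOf-nonNeg (y ∷ ys) = ≤-trans (maxOf-nonNeg ys) (p≤q⊔p (g y) (maxOf g ys))

    sumOf-^-nonNeg : ∀ N ys → 0ℚ ≤ℚ sumOf (λ y → g y ^ N) ys
    sumOf-^-nonNeg N []       = ≤-refl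
    sumOf-^-nonNeg N (y ∷ ys) = ≤-trans (^-nonNeg N (g≥0 y)) (p≤p+q (sumOf-^-nonNeg N ys))

    maxOf-^≤sumOf-^ : ∀ n ys → maxOf g ys ^ suc n ≤ℚ sumOf (λ y → g y ^ suc n) ys
    maxOf-^≤sumOf-^ n []       = ≤-reflexive (*-zeroˡ (0ℚ ^ n))
    maxOf-^≤sumOf-^ n (y ∷ ys) with ⊔-sel (g y) (maxOf g ys)
    ... | inj₁ max≡gy rewrite max≡gy = p≤p+q (sumOf-^-nonNeg (suc n) ys)
    ... | inj₂ max≡rest rewrite max≡rest =
      ≤-trans (maxOf-^≤sumOf-^ n ys) (q≤p+q (^-nonNeg (suc n) (g≥0 y)))

    sumOf-^≤length·maxOf-^ : ∀ N ys → sumOf (λ y → g y ^ N) ys ≤ℚ length ys · maxOf g ys ^ N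
    sumOf-^≤length·maxOf-^ N []       = ≤-refl
    sumOf-^≤length·maxOf-^ N (y ∷ ys) = +-mono-≤
      (^-mono-≤ N (g≥0 y) (p≤p⊔q (g y) (maxOf g ys)))
      (≤-trans (sumOf-^≤length·maxOf-^ N ys)
               (·-monoʳ-≤ (length ys) (^-mono-≤ N (maxOf-nonNeg ys) (p≤q⊔p (g y) (maxOf g ys)))))

LogSupermodularAt : {X : Set} → (X → ℚ) → X → X → X → X → Set
LogSupermodularAt F u v w z = F u * F v ≤ℚ F w * F z ⊎ (F w ≡ 0ℚ × F z ≡ 0ℚ)

logSupermodularAt-limit : {X : Set} (G : X → ℚ) (F : ℕ → X → ℚ) (K : ℕ) →
  (∀ x → 0ℚ ≤ℚ G x) →
  (∀ n x → G x ^ suc n ≤ℚ F (suc n) x) →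
  (∀ N x → F N x ≤ℚ K · G x ^ N) →
  ∀ {u v w z} → (∀ n → LogSupermodularAt (F (suc n)) u v w z) → LogSupermodularAt G u v w z
logSupermodularAt-limit G F K G≥0 G^≤F F≤K·G^ {u} {v} {w} {z} F-lsm
  with G u * G v ≤? G w * G z
... | yes G-lsm = inj₁ G-lsm
... | no  G-¬lsm with ^-dominates-· (K ℕ.* K) (*-nonNeg (G≥0 w) (G≥0 z)) (≰⇒> G-¬lsm)
...   | n , dominates with F-lsm n
...     | inj₁ F-ineq = ⊥-elim (<-irrefl refl (<-≤-trans dominates (begin
  (G u * G v) ^ N                  ≡⟨ ^-distrib-* (G u) (G v) N ⟩
  G u ^ N * G v ^ N                ≤⟨ *-mono-≤-nonNeg (F≥0 u) (^-nonNeg N (G≥0 v)) (G^≤F n u) (G^≤F n v) ⟩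
  F N u * F N v                    ≤⟨ F-ineq ⟩
  F N w * F N z                    ≤⟨ *-mono-≤-nonNeg (·-nonNeg K (^-nonNeg N (G≥0 w))) (F≥0 z)
                                                      (F≤K·G^ N w) (F≤K·G^ N z) ⟩
  (K · G w ^ N) * (K · G z ^ N)    ≡⟨ ·-*-· K K (G w ^ N) (G z ^ N) ⟩
  (K ℕ.* K) · (G w ^ N * G z ^ N)  ≡⟨ cong ((K ℕ.* K) ·_) (sym (^-distrib-* (G w) (G z) N)) ⟩
  (K ℕ.* K) · (G w * G z) ^ N      ∎)))
  where
  open ≤-Reasoning
  N : ℕ
  N = suc n
  F≥0 : ∀ x → 0ℚ ≤ℚ F N x
  F≥0 x = ≤-trans (^-nonNeg N (G≥0 x)) (G^≤F n x)
...     | inj₂ (Fw≡0 , Fz≡0) = inj₂ (vanishes w Fw≡0 , vanishes z Fz≡0)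
  where
  vanishes : ∀ x → F (suc n) x ≡ 0ℚ → G x ≡ 0ℚ
  vanishes x Fx≡0 = ^≤0⇒≡0 n (G≥0 x) (subst (G x ^ suc n ≤ℚ_) Fx≡0 (G^≤F n x))

q-foldr-min : {A : Set} (h : A → Cost) (xs : List A) →
              Cost.q (foldr _min_ ∞ (map h xs)) ≡ maxOf (Cost.q ∘ h) xs
q-foldr-min h []       = refl
q-foldr-min h (x ∷ xs) = cong (Cost.q (h x) ⊔_) (q-foldr-min h xs)

module Evaluations {d : ℕ} (𝓕 : FunSet d ℚ) where

  module MinSum     = Eval d Cost (ℓSet 𝓕) eq _⊕_ 𝟘 _min_ ∞
  module SumProduct = Eval d ℚ 𝓕 EQ _*_ 1ℚ _+_ 0ℚ
  module MaxProduct = Eval d ℚ 𝓕 EQ _*_ 1ℚ _⊔_ 0ℚ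

  EQ-nonNeg : (x : Fin 2 → Fin d) → 0ℚ ≤ℚ EQ x
  EQ-nonNeg x with x Fin.zero Fin.≟ x (Fin.suc Fin.zero)
  ... | yes _ = nonNegative⁻¹ 1ℚ
  ... | no  _ = ≤-refl

  unℓAtom : {V : Set} → Atom d Cost (ℓSet 𝓕) V → Atom d ℚ 𝓕 V
  unℓAtom (eqA u v)               = eqA u v
  unℓAtom (fnA k _ (F , F∈𝓕 , _) s) = fnA k F F∈𝓕 s

  unℓ : {n : ℕ} → Formula d Cost (ℓSet 𝓕) n → Formula d ℚ 𝓕 n
  unℓ (formula m atoms) = formula m (map unℓAtom atoms)

  q-eq : (x : Fin 2 → Fin d) → Cost.q (eq x) ≡ EQ x
  q-eq x with x Fin.zero Fin.≟ x (Fin.suc Fin.zero)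
  ... | yes _ = refl
  ... | no  _ = refl

  q-evalAtom : {V : Set} (σ : V → Fin d) (t : Atom d Cost (ℓSet 𝓕) V) →
               Cost.q (MinSum.evalAtom σ t) ≡ SumProduct.evalAtom σ (unℓAtom t)
  q-evalAtom σ (eqA u v)               = q-eq (pair (σ u) (σ v))
  q-evalAtom σ (fnA k f (F , _ , f≡ℓF) s) = cong Cost.q (f≡ℓF (σ ∘ s))

  q-foldr-⊕ : {V : Set} (σ : V → Fin d) (atoms : List (Atom d Cost (ℓSet 𝓕) V)) →
              Cost.q (foldr _⊕_ 𝟘 (map (MinSum.evalAtom σ) atoms))
                ≡ productOf (SumProduct.evalAtom σ) (map unℓAtom atoms)
  q-foldr-⊕ σ []           = refl
  q-foldr-⊕ σ (t ∷ atoms) = cong₂ _*_ (q-evalAtom σ t) (q-foldr-⊕ σ atoms)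

  q-eval : {n : ℕ} (φ : Formula d Cost (ℓSet 𝓕) n) (x : Fin n → Fin d) →
           Cost.q (MinSum.eval φ x) ≡ MaxProduct.eval (unℓ φ) x
  q-eval (formula m atoms) x =
    trans (q-foldr-min _ (assignments d m))
          (cong (foldr _⊔_ 0ℚ) (map-cong (λ y → q-foldr-⊕ [ x , y ] atoms) (assignments d m)))

  _^ᶠ_ : {n : ℕ} → Formula d ℚ 𝓕 n → ℕ → Formula d ℚ 𝓕 n
  formula m atoms ^ᶠ N = formula m (concat (replicate N atoms))

  module PowerBounds (𝓕≥0 : ∀ k F → 𝓕 k F → ∀ x → 0ℚ ≤ℚ F x) where

    evalAtom-nonNeg : {V : Set} (σ : V → Fin d) (t : Atom d ℚ 𝓕 V) → 0ℚ ≤ℚ SumProduct.evalAtom σ t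
    evalAtom-nonNeg σ (eqA u v)       = EQ-nonNeg (pair (σ u) (σ v))
    evalAtom-nonNeg σ (fnA k F F∈𝓕 s) = 𝓕≥0 k F F∈𝓕 (σ ∘ s)

    module _ {n : ℕ} (ψ : Formula d ℚ 𝓕 n) where

      open Formula ψ

      weight : (Fin n → Fin d) → (Fin m → Fin d) → ℚ
      weight x y = productOf (SumProduct.evalAtom [ x , y ]) atoms

      weight-nonNeg : ∀ x y → 0ℚ ≤ℚ weight x y
      weight-nonNeg x y = productOf-nonNeg (evalAtom-nonNeg [ x , y ]) atoms

      maxProduct-nonNeg : ∀ x → 0ℚ ≤ℚ MaxProduct.eval ψ x
      maxProduct-nonNeg x = maxOf-nonNeg (weight-nonNeg x) (assignments d m)

      sumProduct-^ᶠ : ∀ N x → SumProduct.eval (ψ ^ᶠ N) x ≡ sumOf (λ y → weight x y ^ N) (assignments d m)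
      sumProduct-^ᶠ N x = cong (foldr _+_ 0ℚ)
        (map-cong (λ y → productOf-concat-replicate (SumProduct.evalAtom [ x , y ]) N atoms) (assignments d m))

      maxProduct-^≤sumProduct-^ᶠ : ∀ k x → MaxProduct.eval ψ x ^ suc k ≤ℚ SumProduct.eval (ψ ^ᶠ suc k) x
      maxProduct-^≤sumProduct-^ᶠ k x = subst (MaxProduct.eval ψ x ^ suc k ≤ℚ_) (sym (sumProduct-^ᶠ (suc k) x))
        (maxOf-^≤sumOf-^ (weight-nonNeg x) k (assignments d m))

      sumProduct-^ᶠ≤·maxProduct-^ : ∀ N x →
        SumProduct.eval (ψ ^ᶠ N) x ≤ℚ length (assignments d m) · MaxProduct.eval ψ x ^ N
      sumProduct-^ᶠ≤·maxProduct-^ N x =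
        subst (_≤ℚ length (assignments d m) · MaxProduct.eval ψ x ^ N) (sym (sumProduct-^ᶠ N x))
          (sumOf-^≤length·maxOf-^ (weight-nonNeg x) N (assignments d m))

lemma8 : (d : ℕ) → 2 ≤ d → (𝓕 : FunSet d ℚ) →
           (∀ k F → 𝓕 k F → ∀ x → (0ℚ ≤ℚ F x) × (F x ≤ℚ 1ℚ)) →
           WeaklyLogSupermodular 𝓕 → WeaklySubmodular (ℓSet 𝓕)
lemma8 d _ 𝓕 𝓕⊆[0,1] 𝓕-wlsm f (φ , φ≡f) a b =
  Sum.map (subst₂ _≼_ (cong₂ _⊕_ (ℓG≡f (pair a a)) (ℓG≡f (pair b b)))
                      (cong₂ _⊕_ (ℓG≡f (pair a b)) (ℓG≡f (pair b a))))
          (Prod.map (G≡0⇒f≡∞ (pair a a)) (G≡0⇒f≡∞ (pair b b)))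
          (logSupermodularAt-limit G F K (maxProduct-nonNeg ψ)
            (maxProduct-^≤sumProduct-^ᶠ ψ) (sumProduct-^ᶠ≤·maxProduct-^ ψ)
            (λ n → 𝓕-wlsm (F (suc n)) (ψ ^ᶠ suc n , λ _ → refl) a b))
  where
  open Evaluations 𝓕
  𝓕≥0 : ∀ k F → 𝓕 k F → ∀ x → 0ℚ ≤ℚ F x
  𝓕≥0 k F F∈𝓕 x = proj₁ (𝓕⊆[0,1] k F F∈𝓕 x)
  open PowerBounds 𝓕≥0
  ψ : Formula d ℚ 𝓕 2
  ψ = unℓ φ
  G : Fun d 2 ℚ
  G = MaxProduct.eval ψ
  F : ℕ → Fun d 2 ℚ
  F N = SumProduct.eval (ψ ^ᶠ N)
  K : ℕ
  K = length (assignments d (Formula.m ψ))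
  ℓG≡f : ∀ x → ℓ G x ≡ f x
  ℓG≡f x = trans (cong e^- (sym (q-eval φ x))) (φ≡f x)
  G≡0⇒f≡∞ : ∀ x → G x ≡ 0ℚ → f x ≡ ∞
  G≡0⇒f≡∞ x G≡0 = trans (sym (ℓG≡f x)) (cong e^- G≡0)
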